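{- Let $G$ be a connected $3K_1$-free graph and $u\in V(G)$. Then $G$ has a Hamiltonian path starting at $u$ if and only if $u$ is not an articulation point of $G$.
   Context: Graphs are finite, simple and undirected. $3K_1$-free means no independent set of size 3. An articulation point is a vertex $x$ such that $G-\{x\}$ is disconnected. A Hamiltonian path is a path containing all vertices of $G$. -}

module Defs where

open import Data.Nat using (ℕ)
open import Data.Fin using (Fin)
open import Data.Bool using (Bool; true; false)
open import Data.Unit using (⊤)
open import Data.List using (List; _∷_)
open import Data.List.Membership.Propositional using (_∈_)
open import Data.List.Relation.Unary.Unique.Propositional using (Unique)
open import Data.List.Relation.Unary.Linked using (Linked)
open import Data.Product using (_×_)
open import Relation.Binary.PropositionalEquality using (_≡_; _≢_)
open import Relation.Nullary using (¬_)

record Graph (n : ℕ) : Set where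
  field
    adj    : Fin n → Fin n → Bool
    sym    : ∀ u v → adj u v ≡ adj v u
    irrefl : ∀ v → adj v v ≡ false

open Graph public

Adj : ∀ {n} → Graph n → Fin n → Fin n → Set
Adj G u v = adj G u v ≡ true

data WalkIn {n : ℕ} (G : Graph n) (P : Fin n → Set) : Fin n → Fin n → Set where
  here : ∀ {u} → P u → WalkIn G P u u
  step : ∀ {u w v} → P u → Adj G u w → WalkIn G P w v → WalkIn G P u v

Connected : ∀ {n} → Graph n → Set
Connected {n} G = ∀ (u v : Fin n) → WalkIn G (λ _ → ⊤) u v

ConnectedWithout : ∀ {n} → Graph n → Fin n → Set
ConnectedWithout G x = ∀ u v → u ≢ x → v ≢ x → WalkIn G (λ w → w ≢ x) u v

IsArticulation : ∀ {n} → Graph n → Fin n → Set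
IsArticulation G x = ¬ ConnectedWithout G x

ThreeK1Free : ∀ {n} → Graph n → Set
ThreeK1Free G = ∀ a b c → a ≢ b → b ≢ c → a ≢ c →
  ¬ (¬ Adj G a b × ¬ Adj G b c × ¬ Adj G a c)

record HamPathFrom {n : ℕ} (G : Graph n) (u : Fin n) : Set where
  field
    rest     : List (Fin n)
    linked   : Linked (Adj G) (u ∷ rest)
    unique   : Unique (u ∷ rest)
    covering : ∀ v → v ∈ (u ∷ rest)

-- Backward direction: grow a path from u one vertex at a time. If z lies outside
-- the path u … a y … e and is adjacent to a path vertex y ≠ u with predecessor a,
-- then among the pairwise distinct z, a, e two are adjacent (3K₁-freeness), and
-- accordingly z is appended after e, inserted between a and y, or the path is
-- rerouted as u … a e … y z. Such a y exists as long as the path misses a vertex,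
-- because G − u is connected. Forward direction: the Hamiltonian path minus u is
-- a path through all of G − u.
module Submission where

open import Defs
open import Data.Nat using (ℕ; zero; suc; _≤_; _+_; s≤s)
open import Data.Nat.Properties using (+-suc; +-identityʳ; <⇒≱; ≮⇒≥; ≤-refl; suc-injective; module ≤-Reasoning)
open import Data.Fin using (Fin; zero; suc; _≟_)
open import Data.Fin.Properties using (any?; all?; ¬∀⟶∃¬; pigeonhole; <⇒≢)
open import Data.Bool using (true)
import Data.Bool as Bool
open import Data.Empty using (⊥-elim)
open import Data.Product using (∃; ∃₂; _×_; _,_)
open import Data.Sum using (_⊎_; inj₁; inj₂)
open import Data.List using (List; []; _∷_; _++_; [_]; length; lookup)
open import Data.List.Relation.Unary.All using (All; []; _∷_)
import Data.List.Relation.Unary.All as All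
open import Data.List.Relation.Unary.All.Properties using (¬Any⇒All¬)
open import Data.List.Relation.Unary.Any using (here; there)
import Data.List.Relation.Unary.Any as Any
open import Data.List.Relation.Unary.AllPairs using ([]; _∷_)
import Data.List.Relation.Unary.AllPairs as AllPairs
open import Data.List.Relation.Unary.Linked using (Linked; [-]; _∷_)
import Data.List.Relation.Unary.Linked as Linked
open import Data.List.Relation.Unary.Unique.Propositional using (Unique)
open import Data.List.Membership.Propositional using (_∈_; _∉_)
open import Data.List.Membership.Propositional.Properties using (∈-++⁺ˡ; ∈-++⁺ʳ; ∈-∃++; ∈-lookup)
open import Data.List.Relation.Binary.Permutation.Propositional using (_↭_; refl; prep; swap; trans; ↭-sym; ↭⇒↭ₛ; module PermutationReasoning)
open import Data.List.Relation.Binary.Permutation.Propositional.Properties using (↭-length; ++⁺ˡ; shift; ∷↭∷ʳ)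
import Data.List.Relation.Binary.Permutation.Setoid.Properties as PermutationSetoid
open import Function.Bundles using (_⇔_; mk⇔)
open import Function using (case_of_)
open import Relation.Nullary using (¬_; Dec; yes; no; ¬?)
open import Relation.Nullary.Decidable using (_×-dec_; decidable-stable)
open import Relation.Binary.PropositionalEquality using (_≡_; _≢_; refl; cong; subst; setoid; ≢-sym) renaming (sym to ≡-sym; trans to ≡-trans)

Unique-resp-↭ : ∀ {A : Set} {xs ys : List A} → xs ↭ ys → Unique xs → Unique ys
Unique-resp-↭ π = PermutationSetoid.Unique-resp-↭ (setoid _) (↭⇒↭ₛ π)

Unique⇒lookup-injective : ∀ {A : Set} {xs : List A} → Unique xs →
                          ∀ {i j} → lookup xs i ≡ lookup xs j → i ≡ j
Unique⇒lookup-injective (_ ∷ _) {zero} {zero} _ = refl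
Unique⇒lookup-injective (x∉ ∷ _) {zero} {suc j} eq =
  ⊥-elim (All.lookup x∉ (∈-lookup j) eq)
Unique⇒lookup-injective (x∉ ∷ _) {suc i} {zero} eq =
  ⊥-elim (All.lookup x∉ (∈-lookup i) (≡-sym eq))
Unique⇒lookup-injective (_ ∷ u) {suc i} {suc j} eq =
  cong suc (Unique⇒lookup-injective u eq)

Unique⇒length≤ : ∀ {n} {xs : List (Fin n)} → Unique xs → length xs ≤ n
Unique⇒length≤ {xs = xs} u = ≮⇒≥ λ n<∣xs∣ →
  let i , j , i<j , eq = pigeonhole n<∣xs∣ (lookup xs)
  in <⇒≢ i<j (Unique⇒lookup-injective u eq)

Unique-++⇒disjoint : ∀ {A : Set} (xs ys : List A) {x y} →
                     Unique (xs ++ ys) → x ∈ xs → y ∈ ys → x ≢ y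
Unique-++⇒disjoint (_ ∷ xs) ys (x∉ ∷ _) (here refl) y∈ = All.lookup x∉ (∈-++⁺ʳ xs y∈)
Unique-++⇒disjoint (_ ∷ xs) ys (_ ∷ u) (there x∈) y∈ = Unique-++⇒disjoint xs ys u x∈ y∈

module _ {n : ℕ} (G : Graph n) where

  open import Data.List.Membership.DecPropositional (_≟_ {n}) using (_∈?_)

  Adj-sym : ∀ {a b} → Adj G a b → Adj G b a
  Adj-sym {a} {b} ab = ≡-trans (Graph.sym G b a) ab

  adj? : ∀ a b → Dec (Adj G a b)
  adj? a b = adj G a b Bool.≟ true

  someAdjacent : ThreeK1Free G → ∀ {a b c} → a ≢ b → b ≢ c → a ≢ c →
                 Adj G a b ⊎ Adj G b c ⊎ Adj G a c
  someAdjacent K {a} {b} {c} a≢b b≢c a≢c with adj? a b | adj? b c | adj? a c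
  ... | yes ab | _      | _      = inj₁ ab
  ... | no _   | yes bc | _      = inj₂ (inj₁ bc)
  ... | no _   | no _   | yes ac = inj₂ (inj₂ ac)
  ... | no ¬ab | no ¬bc | no ¬ac = ⊥-elim (K a b c a≢b b≢c a≢c (¬ab , ¬bc , ¬ac))

  data Chain : Fin n → List (Fin n) → Fin n → Set where
    []  : ∀ {a} → Chain a [] a
    _∷_ : ∀ {a b c vs} → Adj G a b → Chain b vs c → Chain a (b ∷ vs) c

  Chain⇒Linked : ∀ {a vs b} → Chain a vs b → Linked (Adj G) (a ∷ vs)
  Chain⇒Linked []       = [-]
  Chain⇒Linked (ab ∷ c) = ab ∷ Chain⇒Linked c

  last∈ : ∀ {a vs b} → Chain a vs b → b ∈ a ∷ vs
  last∈ []      = here refl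
  last∈ (_ ∷ c) = there (last∈ c)

  append : ∀ {a b c d vs ws} → Chain a vs b → Adj G b c → Chain c ws d → Chain a (vs ++ c ∷ ws) d
  append []       bc c′ = bc ∷ c′
  append (ab ∷ c) bc c′ = ab ∷ append c bc c′

  split : ∀ vs {a e y ws} → Chain a (vs ++ y ∷ ws) e →
          ∃ λ b → Chain a vs b × Adj G b y × Chain y ws e
  split []       {a} (ay ∷ c) = a , [] , ay , c
  split (_ ∷ vs) (ab ∷ c) with split vs c
  ... | b , c₁ , by , c₂ = b , ab ∷ c₁ , by , c₂

  reverse : ∀ {a vs b} → Chain a vs b → ∃ λ ws → Chain b ws a × (b ∷ ws ↭ a ∷ vs)
  reverse [] = [] , [] , refl
  reverse {a} (ab ∷ c) with reverse c
  ... | ws , c′ , π = ws ++ [ a ] , append c′ (Adj-sym ab) [] ,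
                      trans (↭-sym (∷↭∷ʳ a (_ ∷ ws))) (prep a π)

  Extension : Fin n → List (Fin n) → Fin n → Set
  Extension u vs z = ∃₂ λ vs′ e′ → Chain u vs′ e′ × (u ∷ vs′ ↭ z ∷ u ∷ vs)

  absorbAt : ThreeK1Free G → ∀ {u e y z} vs ws → Chain u (vs ++ y ∷ ws) e →
             Unique (u ∷ vs ++ y ∷ ws) → z ∉ u ∷ vs ++ y ∷ ws → Adj G y z →
             Extension u (vs ++ y ∷ ws) z
  absorbAt K {u} {e} {y} {z} vs ws c uq z∉ yz with split vs c
  ... | a , ua , ay , ye = case someAdjacent K a≢e e≢z a≢z of λ where
      (inj₁ ae) → let rs , ey , π = reverse ye in
        _ , z , append ua ae (append ey yz []) ,
        (begin
          u ∷ vs ++ e ∷ rs ++ [ z ] ↭⟨ ++⁺ˡ (u ∷ vs) (↭-sym (∷↭∷ʳ z (e ∷ rs))) ⟩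
          u ∷ vs ++ z ∷ e ∷ rs     ↭⟨ ++⁺ˡ (u ∷ vs) (prep z π) ⟩
          u ∷ vs ++ z ∷ y ∷ ws     ↭⟨ shift z (u ∷ vs) (y ∷ ws) ⟩
          z ∷ u ∷ vs ++ y ∷ ws     ∎)
      (inj₂ (inj₁ ez)) → _ , z , append c ez [] , ↭-sym (∷↭∷ʳ z (u ∷ vs ++ y ∷ ws))
      (inj₂ (inj₂ az)) → _ , e , append ua az (Adj-sym yz ∷ ye) , shift z (u ∷ vs) (y ∷ ws)
    where
    open PermutationReasoning
    a∈ : a ∈ u ∷ vs ++ y ∷ ws
    a∈ = ∈-++⁺ˡ (last∈ ua)
    e∈ : e ∈ u ∷ vs ++ y ∷ ws
    e∈ = ∈-++⁺ʳ (u ∷ vs) (last∈ ye)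
    a≢e : a ≢ e
    a≢e = Unique-++⇒disjoint (u ∷ vs) (y ∷ ws) uq (last∈ ua) (last∈ ye)
    e≢z : e ≢ z
    e≢z refl = z∉ e∈
    a≢z : a ≢ z
    a≢z refl = z∉ a∈

  absorb : ThreeK1Free G → ∀ {u vs e y z} → Chain u vs e → Unique (u ∷ vs) →
           y ∈ vs → z ∉ u ∷ vs → Adj G y z → Extension u vs z
  absorb K c uq y∈ with ∈-∃++ y∈
  ... | vs , ws , refl = absorbAt K vs ws c uq

  leavingEdge : ∀ {Q a b} L → WalkIn G Q a b → a ∈ L → b ∉ L →
                ∃₂ λ y z → Q y × y ∈ L × z ∉ L × Adj G y z
  leavingEdge L (here _) a∈ b∉ = ⊥-elim (b∉ a∈)
  leavingEdge L (step {w = w} qa aw p) a∈ b∉ with w ∈? L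
  ... | yes w∈ = leavingEdge L p w∈ b∉
  ... | no w∉  = _ , w , qa , a∈ , w∉ , aw

  EdgeOut : List (Fin n) → List (Fin n) → Set
  EdgeOut A B = ∃₂ λ y z → y ∈ A × z ∉ B × Adj G y z

  edgeOut? : ∀ A B → Dec (EdgeOut A B)
  edgeOut? A B = any? λ y → any? λ z → (y ∈? A) ×-dec ¬? (z ∈? B) ×-dec adj? y z

  ConnectedWithout⇒edgeOut : ∀ {u x r rs} → ConnectedWithout G u → Unique (u ∷ r ∷ rs) →
                             x ∉ u ∷ r ∷ rs → EdgeOut (r ∷ rs) (u ∷ r ∷ rs)
  ConnectedWithout⇒edgeOut {u} {x} {r} {rs} cw (u∉ ∷ _) x∉
    with leavingEdge (u ∷ r ∷ rs) (cw r x (≢-sym (All.head u∉)) (λ x≡u → x∉ (here x≡u)))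
                     (there (here refl)) x∉
  ... | y , z , y≢u , y∈ , z∉ , yz = y , z , Any.tail y≢u y∈ , z∉ , yz

  -- ¬ IsArticulation is a double negation; decidability of EdgeOut removes it.
  edgeOutOfTail : ∀ {u x r rs} → ¬ IsArticulation G u → Unique (u ∷ r ∷ rs) →
                  x ∉ u ∷ r ∷ rs → EdgeOut (r ∷ rs) (u ∷ r ∷ rs)
  edgeOutOfTail nart uq x∉ =
    decidable-stable (edgeOut? _ _) λ ¬out → nart λ cw → ¬out (ConnectedWithout⇒edgeOut cw uq x∉)

  grow : Connected G → ThreeK1Free G → ∀ {u x vs e} → ¬ IsArticulation G u →
         Chain u vs e → Unique (u ∷ vs) → x ∉ u ∷ vs → ∃ λ z → z ∉ u ∷ vs × Extension u vs z
  grow conn K {u} {x} nart [] uq x∉ with leavingEdge [ u ] (conn u x) (here refl) x∉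
  ... | _ , z , _ , here refl , z∉ , uz = z , z∉ , [ z ] , z , uz ∷ [] , swap u z refl
  grow conn K nart c@(_ ∷ _) uq x∉ with edgeOutOfTail nart uq x∉
  ... | y , z , y∈ , z∉ , yz = z , z∉ , absorb K c uq y∈ z∉ yz

  extendToHamiltonian : Connected G → ThreeK1Free G → ∀ {u} → ¬ IsArticulation G u →
                    (m : ℕ) → ∀ {vs e} → Chain u vs e → Unique (u ∷ vs) → n ≤ length vs + m →
                    HamPathFrom G u
  extendToHamiltonian conn K nart zero {vs} c uq n≤ =
    ⊥-elim (<⇒≱ (s≤s (subst (n ≤_) (+-identityʳ (length vs)) n≤)) (Unique⇒length≤ uq))
  extendToHamiltonian conn K {u} nart (suc m) {vs} c uq n≤ with all? (_∈? u ∷ vs)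
  ... | yes covers = record { rest = vs ; linked = Chain⇒Linked c ; unique = uq ; covering = covers }
  ... | no ¬covers with ¬∀⟶∃¬ n _ (_∈? u ∷ vs) ¬covers
  ... | x , x∉ with grow conn K nart c uq x∉
  ... | z , z∉ , vs′ , _ , c′ , π = extendToHamiltonian conn K nart m c′ uq′ n≤′
    where
    uq′ : Unique (u ∷ vs′)
    uq′ = Unique-resp-↭ (↭-sym π) (¬Any⇒All¬ (u ∷ vs) z∉ ∷ uq)
    n≤′ : n ≤ length vs′ + m
    n≤′ = begin
      n                     ≤⟨ n≤ ⟩
      length vs + suc m     ≡⟨ +-suc (length vs) m ⟩
      suc (length vs) + m   ≡⟨ cong (_+ m) (suc-injective (↭-length π)) ⟨
      length vs′ + m        ∎
      where open ≤-Reasoning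

  module _ {Q : Fin n → Set} where

    source : ∀ {a b} → WalkIn G Q a b → Q a
    source (here qa)     = qa
    source (step qa _ _) = qa

    joinAtSource : ∀ {a v w} → WalkIn G Q a v → WalkIn G Q a w → WalkIn G Q v w
    joinAtSource (here _)      q = q
    joinAtSource (step _ ab p) q = joinAtSource p (step (source p) (Adj-sym ab) q)

    fromHead : ∀ {a v} vs → Linked (Adj G) (a ∷ vs) → All Q (a ∷ vs) → v ∈ a ∷ vs →
               WalkIn G Q a v
    fromHead _        _        (qa ∷ _)  (here refl) = here qa
    fromHead (_ ∷ vs) (ab ∷ l) (qa ∷ qs) (there v∈)  = step qa ab (fromHead vs l qs v∈)

    Linked⇒connectedIn : ∀ {vs v w} → Linked (Adj G) vs → All Q vs → v ∈ vs → w ∈ vs →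
                         WalkIn G Q v w
    Linked⇒connectedIn {_ ∷ vs} l qs v∈ w∈ =
      joinAtSource (fromHead vs l qs v∈) (fromHead vs l qs w∈)

  HamPathFrom⇒ConnectedWithout : ∀ {u} → HamPathFrom G u → ConnectedWithout G u
  HamPathFrom⇒ConnectedWithout hp v w v≢u w≢u =
    Linked⇒connectedIn (Linked.tail linked) (All.map ≢-sym (AllPairs.head unique))
                       (Any.tail v≢u (covering v)) (Any.tail w≢u (covering w))
    where open HamPathFrom hp

theorem9 : ∀ {n : ℕ} (G : Graph n) → Connected G → ThreeK1Free G →
    (u : Fin n) → HamPathFrom G u ⇔ (¬ IsArticulation G u)
theorem9 {n} G conn K _ = mk⇔
  (λ hp isArticulation → isArticulation (HamPathFrom⇒ConnectedWithout G hp))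
  (λ nart → extendToHamiltonian G conn K nart n [] ([] ∷ []) ≤-refl)
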